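{- Let $n = p_1^{a_1} p_2^{a_2} \cdots p_r^{a_r}$ where $p_1, \dots, p_r$ are distinct primes, $a_i \geq 1$, and $r \geq 2$, and let $n' = p_1 p_2 \cdots p_r$. Then $M(n) = M(n')$.
   Context: For a positive integer $n$, the unitary Cayley graph $X_n = \mathrm{Cay}(\mathbb{Z}_n, U_n)$ has vertex set $\mathbb{Z}_n$, and $x,y$ are adjacent iff $x - y \in U_n$, the group of units of $\mathbb{Z}_n$. An induced cycle of length $k \geq 3$ is a sequence of $k$ distinct vertices $v_0, \dots, v_{k-1}$ such that $v_i$ and $v_j$ are adjacent if and only if $i - j \equiv \pm 1 \pmod k$. $M(n)$ denotes the length of the longest induced cycle in $X_n$. -}

module Defs where

open import Data.Nat using (ℕ; zero; suc; _+_; _∸_; _<_; _≤_; _≡ᵇ_)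
open import Data.Nat.DivMod using (_%_)
open import Data.Nat.Coprimality using (Coprime)
open import Data.Fin using (Fin; toℕ)
open import Data.Product using (Σ; _×_; ∃)
open import Data.Sum using (_⊎_)
open import Function.Bundles using (_⇔_)
open import Relation.Binary.PropositionalEquality using (_≡_)

-- Vertices of X_n are the naturals x < n (representatives of ℤ_n).
-- The difference x - y in ℤ_n, represented in {0,…,n-1} (for x, y < n).
diffMod : (n x y : ℕ) → ℕ
diffMod zero    x y = zero
diffMod (suc m) x y = (x + (suc m ∸ y)) % suc m

IsUnit : (n k : ℕ) → Set
IsUnit n k = Coprime k n

-- Adjacency in the unitary Cayley graph X_n = Cay(ℤ_n, U_n).
Adj : (n x y : ℕ) → Set
Adj n x y = IsUnit n (diffMod n x y)

SuccMod : (k : ℕ) → Fin k → Fin k → Set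
SuccMod k i j = (suc (toℕ i) ≡ toℕ j) ⊎ (suc (toℕ i) ≡ k × toℕ j ≡ 0)

CycNbr : (k : ℕ) → Fin k → Fin k → Set
CycNbr k i j = SuccMod k i j ⊎ SuccMod k j i

record InducedCycle (n k : ℕ) : Set where
  field
    k≥3      : 3 ≤ k
    v        : Fin k → ℕ
    inRange  : ∀ i → v i < n
    distinct : ∀ i j → v i ≡ v j → i ≡ j
    induced  : ∀ i j → Adj n (v i) (v j) ⇔ CycNbr k i j

-- "M(n) = m": m is the length of a longest induced cycle of X_n.
IsM : (n m : ℕ) → Set
IsM n m = InducedCycle n m × (∀ k → InducedCycle n k → k ≤ m)

-- Whether x − y is a unit modulo N depends only on the residues of x and y
-- modulo the primes dividing N, and n, n′ have the same prime divisors with n′ ∣ n.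
-- So an induced cycle of X_{n′} is also one of X_n, and reducing the vertices of an
-- induced cycle of X_n modulo n′ gives an induced cycle of X_{n′}, provided the
-- reduced vertices stay distinct. Two vertices that are congruent modulo n′ have the
-- same neighbourhood, and distinct vertices of a k-cycle never do unless k = 4. So
-- length 4 is the only one that could be lost, and that does not affect the maximum:
-- since r ≥ 2, X_{n′} has an induced 6-cycle.
module Submission where

open import Algebra.Properties.CommutativeSemigroup using (x∙yz≈y∙xz)
open import Data.Fin using (Fin; zero; suc; toℕ; fromℕ; fromℕ<; inject₁)
import Data.Fin.Properties as Fin
open import Data.Fin.Properties
  using (all?; toℕ-injective; toℕ<n; toℕ-fromℕ; toℕ-fromℕ<; toℕ-inject₁)
open import Data.List using ([]; _∷_; tabulate)
open import Data.List.Membership.Propositional.Properties using (∈-tabulate⁺; ∈-tabulate⁻)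
open import Data.List.Relation.Unary.All using (_∷_)
import Data.List.Relation.Unary.All.Properties as All
open import Data.List.Relation.Unary.Any using (Any; here; there)
import Data.List.Relation.Unary.Any.Properties as Any
open import Data.Nat
open import Data.Nat.Coprimality using (Coprime)
open import Data.Nat.DivMod
open import Data.Nat.Divisibility
open import Data.Nat.ListAction using (product)
open import Data.Nat.ListAction.Properties using (∈⇒∣product; product≢0)
open import Data.Nat.Primality
open import Data.Nat.Primality.Factorisation using (factorise; factorisationHasAllPrimeFactors)
open import Data.Nat.Properties
open import Data.Product using (_×_; _,_; ∃-syntax; proj₁; proj₂)
open import Data.Sum using (inj₁; inj₂)
open import Function.Base using (_∘_)
open import Function.Bundles using (_⇔_; mk⇔; Equivalence)
open import Function.Properties.Equivalence using () renaming (trans to ⇔-trans; sym to ⇔-sym)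
open import Relation.Binary.Definitions using (Decidable; Tri; tri<; tri≈; tri>)
open import Relation.Binary.PropositionalEquality
open import Relation.Nullary using (¬_; contradiction; yes; no)
open import Relation.Nullary.Decidable
  using (Dec; from-yes; from-no; ¬?; _⊎-dec_; _×-dec_; _→-dec_)

open import Defs

open Equivalence using (to; from)

infix 4 _≡_[mod_]

_≡_[mod_] : ℕ → ℕ → (d : ℕ) → .{{NonZero d}} → Set
x ≡ y [mod d ] = x % d ≡ y % d

+-congˡ-≡[mod] : ∀ d .{{_ : NonZero d}} n {x y} → x ≡ y [mod d ] → n + x ≡ n + y [mod d ]
+-congˡ-≡[mod] d n {x} {y} x≡y = begin
  (n + x) % d         ≡⟨ %-distribˡ-+ n x d ⟩
  (n % d + x % d) % d ≡⟨ cong (λ z → (n % d + z) % d) x≡y ⟩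
  (n % d + y % d) % d ≡⟨ %-distribˡ-+ n y d ⟨
  (n + y) % d         ∎
  where open ≡-Reasoning

m+n≡n[mod]⇒∣m : ∀ {d} .{{_ : NonZero d}} m n → m + n ≡ n [mod d ] → d ∣ m
m+n≡n[mod]⇒∣m {d} m n m+n≡n = ∣m+n∣m⇒∣n d∣[n/d]d+m (n∣m*n (n / d))
  where
  open ≡-Reasoning
  quotients : n % d + (n / d * d + m) ≡ n % d + (m + n) / d * d
  quotients = begin
    n % d + (n / d * d + m)       ≡⟨ +-assoc (n % d) _ m ⟨
    n % d + n / d * d + m         ≡⟨ cong (_+ m) (m≡m%n+[m/n]*n n d) ⟨
    n + m                         ≡⟨ +-comm n m ⟩
    m + n                         ≡⟨ m≡m%n+[m/n]*n (m + n) d ⟩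
    (m + n) % d + (m + n) / d * d ≡⟨ cong (_+ (m + n) / d * d) m+n≡n ⟩
    n % d + (m + n) / d * d       ∎
  d∣[n/d]d+m : d ∣ n / d * d + m
  d∣[n/d]d+m = subst (d ∣_) (sym (+-cancelˡ-≡ (n % d) _ _ quotients)) (n∣m*n ((m + n) / d))

≡[mod]⇒∣∸ : ∀ {d m n} .{{_ : NonZero d}} → m ≤ n → m ≡ n [mod d ] → d ∣ n ∸ m
≡[mod]⇒∣∸ {d} {m} {n} m≤n m≡n =
  m+n≡n[mod]⇒∣m (n ∸ m) m (trans (cong (_% d) (m∸n+n≡m m≤n)) (sym m≡n))

prime⇒≢1 : ∀ {p} → Prime p → p ≢ 1
prime⇒≢1 p-prime = nonTrivial⇒≢1 {{prime⇒nonTrivial p-prime}}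

prime∣prime⇒≡ : ∀ {p q} → Prime p → Prime q → p ∣ q → p ≡ q
prime∣prime⇒≡ p-prime q-prime p∣q with prime⇒irreducible q-prime p∣q
... | inj₁ p≡1 = contradiction p≡1 (prime⇒≢1 p-prime)
... | inj₂ p≡q = p≡q

prime∤* : ∀ {p m n} → Prime p → p ∤ m → p ∤ n → p ∤ m * n
prime∤* {m = m} {n} p-prime p∤m p∤n p∣mn with euclidsLemma m n p-prime p∣mn
... | inj₁ p∣m = p∤m p∣m
... | inj₂ p∣n = p∤n p∣n

*-cancelʳ-≡[mod] : ∀ {ℓ m n o} .{{_ : NonZero ℓ}} → Prime ℓ → ℓ ∤ o →
                   m < ℓ → n < ℓ → m * o ≡ n * o [mod ℓ ] → m ≡ n
*-cancelʳ-≡[mod] {ℓ} {m} {n} {o} ℓ-prime ℓ∤o m<ℓ n<ℓ mo≡no = byTrichotomy (<-cmp m n)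
  where
  noCollision : ∀ {a b} → a < b → b < ℓ → ¬ a * o ≡ b * o [mod ℓ ]
  noCollision {a} {b} a<b b<ℓ ao≡bo =
    prime∤* ℓ-prime ℓ∤b∸a ℓ∤o (subst (ℓ ∣_) (sym (*-distribʳ-∸ o b a))
                                 (≡[mod]⇒∣∸ (*-monoˡ-≤ o (<⇒≤ a<b)) ao≡bo))
    where
    ℓ∤b∸a : ℓ ∤ b ∸ a
    ℓ∤b∸a = >⇒∤ {{>-nonZero (m<n⇒0<n∸m a<b)}} (≤-<-trans (m∸n≤m b a) b<ℓ)
  byTrichotomy : Tri (m < n) (m ≡ n) (n < m) → m ≡ n
  byTrichotomy (tri< m<n _ _) = contradiction mo≡no (noCollision m<n n<ℓ)
  byTrichotomy (tri≈ _ m≡n _) = m≡n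
  byTrichotomy (tri> _ _ n<m) = contradiction (sym mo≡no) (noCollision n<m m<ℓ)

m∣m^n : ∀ {m n} → 1 ≤ n → m ∣ m ^ n
m∣m^n {m} {suc n} _ = m∣m*n (m ^ n)

prime∣m^n⇒∣m : ∀ {ℓ m} → Prime ℓ → ∀ n → ℓ ∣ m ^ n → ℓ ∣ m
prime∣m^n⇒∣m ℓ-prime zero ℓ∣1 = contradiction (∣1⇒≡1 ℓ∣1) (prime⇒≢1 ℓ-prime)
prime∣m^n⇒∣m {m = m} ℓ-prime (suc n) ℓ∣m*m^n with euclidsLemma m (m ^ n) ℓ-prime ℓ∣m*m^n
... | inj₁ ℓ∣m   = ℓ∣m
... | inj₂ ℓ∣m^n = prime∣m^n⇒∣m ℓ-prime n ℓ∣m^n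

prime∣product⇒Any∣ : ∀ {ℓ} → Prime ℓ → ∀ ns → ℓ ∣ product ns → Any (ℓ ∣_) ns
prime∣product⇒Any∣ ℓ-prime []       ℓ∣1 = contradiction (∣1⇒≡1 ℓ∣1) (prime⇒≢1 ℓ-prime)
prime∣product⇒Any∣ ℓ-prime (n ∷ ns) ℓ∣n*ns with euclidsLemma n (product ns) ℓ-prime ℓ∣n*ns
... | inj₁ ℓ∣n  = here ℓ∣n
... | inj₂ ℓ∣ns = there (prime∣product⇒Any∣ ℓ-prime ns ℓ∣ns)

product-tabulate-∣ : ∀ {r} {f g : Fin r → ℕ} → (∀ i → f i ∣ g i) →
                     product (tabulate f) ∣ product (tabulate g)
product-tabulate-∣ {zero}  _   = ∣-refl
product-tabulate-∣ {suc r} f∣g = *-pres-∣ (f∣g zero) (product-tabulate-∣ (f∣g ∘ suc))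

prime∣product-^⇒prime∣product : ∀ {r ℓ} {f a : Fin r → ℕ} → Prime ℓ →
                                ℓ ∣ product (tabulate (λ i → f i ^ a i)) → ℓ ∣ product (tabulate f)
prime∣product-^⇒prime∣product {a = a} ℓ-prime ℓ∣∏
  with i , ℓ∣fᵢ^aᵢ ← Any.tabulate⁻ (prime∣product⇒Any∣ ℓ-prime _ ℓ∣∏)
  = ∣-trans (prime∣m^n⇒∣m ℓ-prime (a i) ℓ∣fᵢ^aᵢ) (∈⇒∣product (∈-tabulate⁺ i))

prime∉⇒∤product : ∀ {r q} {f : Fin r → ℕ} → Prime q → (∀ i → Prime (f i)) →
                  (∀ i → q ≢ f i) → q ∤ product (tabulate f)
prime∉⇒∤product q-prime f-prime q∉f q∣∏
  with i , q≡fᵢ ← ∈-tabulate⁻ (factorisationHasAllPrimeFactors q-prime q∣∏ (All.tabulate⁺ f-prime))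
  = q∉f i q≡fᵢ

coprime⇔noCommonPrimeDivisor : ∀ {m n} .{{_ : NonZero n}} →
                               Coprime m n ⇔ (∀ {ℓ} → Prime ℓ → ¬ (ℓ ∣ m × ℓ ∣ n))
coprime⇔noCommonPrimeDivisor {m} {n} = mk⇔ primeDivisor≢1 commonDivisor≡1
  where
  primeDivisor≢1 : Coprime m n → ∀ {ℓ} → Prime ℓ → ¬ (ℓ ∣ m × ℓ ∣ n)
  primeDivisor≢1 coprime ℓ-prime ℓ∣m×n = prime⇒≢1 ℓ-prime (coprime ℓ∣m×n)
  commonDivisor≡1 : (∀ {ℓ} → Prime ℓ → ¬ (ℓ ∣ m × ℓ ∣ n)) → Coprime m n
  commonDivisor≡1 noPrime {i} (i∣m , i∣n)
    with factorise i {{≢-nonZero λ { refl → ≢-nonZero⁻¹ n (0∣⇒≡0 i∣n) }}}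
  ... | record { factors = [] ; isFactorisation = i≡1 } = i≡1
  ... | record { factors = ℓ ∷ ℓs ; isFactorisation = i≡ℓ*ℓs ; factorsPrime = ℓ-prime ∷ _ } =
    contradiction (∣-trans ℓ∣i i∣m , ∣-trans ℓ∣i i∣n) (noPrime ℓ-prime)
    where
    ℓ∣i : ℓ ∣ i
    ℓ∣i = subst (ℓ ∣_) (sym i≡ℓ*ℓs) (m∣m*n (product ℓs))

∣diffMod⇔≡[mod] : ∀ {N d} .{{_ : NonZero N}} .{{_ : NonZero d}} x {y} →
                  d ∣ N → y ≤ N → d ∣ diffMod N x y ⇔ x ≡ y [mod d ]
∣diffMod⇔≡[mod] {suc n} {d} x {y} d∣N y≤N = mk⇔
  (λ d∣diff → trans (sym t+y≡x) (%-remove-+ˡ y (∣n∣m%n⇒∣m d∣N d∣diff)))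
  (λ x≡y → %-presˡ-∣ (m+n≡n[mod]⇒∣m t y (trans t+y≡x x≡y)) d∣N)
  where
  N = suc n
  t = x + (N ∸ y)
  t+y≡x : t + y ≡ x [mod d ]
  t+y≡x = begin
    (x + (N ∸ y) + y) % d ≡⟨ cong (_% d) (+-assoc x (N ∸ y) y) ⟩
    (x + (N ∸ y + y)) % d ≡⟨ cong (λ z → (x + z) % d) (m∸n+n≡m y≤N) ⟩
    (x + N) % d           ≡⟨ %-remove-+ʳ x d∣N ⟩
    x % d                 ∎
    where open ≡-Reasoning

Apart : ℕ → ℕ → ℕ → Set
Apart N x y = ∀ {ℓ} .{{_ : NonZero ℓ}} → Prime ℓ → ℓ ∣ N → ¬ x ≡ y [mod ℓ ]

adj⇔apart : ∀ {N} .{{_ : NonZero N}} x {y} → y ≤ N → Adj N x y ⇔ Apart N x y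
adj⇔apart {N} x {y} y≤N = mk⇔ adj⇒apart apart⇒adj
  where
  noCommonPrime = coprime⇔noCommonPrimeDivisor {diffMod N x y} {N}
  adj⇒apart : Adj N x y → Apart N x y
  adj⇒apart adj ℓ-prime ℓ∣N x≡y =
    to noCommonPrime adj ℓ-prime (from (∣diffMod⇔≡[mod] x ℓ∣N y≤N) x≡y , ℓ∣N)
  apart⇒adj : Apart N x y → Adj N x y
  apart⇒adj apart = from noCommonPrime λ ℓ-prime (ℓ∣diff , ℓ∣N) →
    let instance _ = prime⇒nonZero ℓ-prime in
    apart ℓ-prime ℓ∣N (to (∣diffMod⇔≡[mod] x ℓ∣N y≤N) ℓ∣diff)

apart-%⇔apart : ∀ {R} .{{_ : NonZero R}} x y → Apart R (x % R) (y % R) ⇔ Apart R x y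
apart-%⇔apart {R} x y = mk⇔ apart-% apart-%⁻¹
  where
  apart-% : Apart R (x % R) (y % R) → Apart R x y
  apart-% apart ℓ-prime ℓ∣R x≡y = apart ℓ-prime ℓ∣R
    (trans (m∣n⇒o%n%m≡o%m _ R x ℓ∣R) (trans x≡y (sym (m∣n⇒o%n%m≡o%m _ R y ℓ∣R))))
  apart-%⁻¹ : Apart R x y → Apart R (x % R) (y % R)
  apart-%⁻¹ apart ℓ-prime ℓ∣R x≡y = apart ℓ-prime ℓ∣R
    (trans (sym (m∣n⇒o%n%m≡o%m _ R x ℓ∣R)) (trans x≡y (m∣n⇒o%n%m≡o%m _ R y ℓ∣R)))

adj-%⇔apart : ∀ {R} .{{_ : NonZero R}} x y → Adj R (x % R) (y % R) ⇔ Apart R x y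
adj-%⇔apart {R} x y = ⇔-trans (adj⇔apart (x % R) (m%n≤n y R)) (apart-%⇔apart x y)

successor : ∀ {k} (i : Fin (suc k)) → ∃[ j ] SuccMod (suc k) i j
successor {k} i with suc (toℕ i) <? suc k
... | yes 1+i<k = fromℕ< 1+i<k , inj₁ (sym (toℕ-fromℕ< 1+i<k))
... | no  1+i≮k = zero , inj₂ (≤-antisym (toℕ<n i) (≮⇒≥ 1+i≮k) , refl)

predecessor : ∀ {k} (j : Fin (suc k)) → ∃[ i ] SuccMod (suc k) i j
predecessor {k}     zero    = fromℕ k , inj₂ (cong suc (toℕ-fromℕ k) , refl)
predecessor {suc k} (suc j) = inject₁ j , inj₁ (cong suc (toℕ-inject₁ j))

succMod⇒≡[mod] : ∀ {k} {i j : Fin (suc k)} → SuccMod (suc k) i j →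
                 suc (toℕ i) ≡ toℕ j [mod suc k ]
succMod⇒≡[mod]     (inj₁ 1+i≡j)         = cong (_% _) 1+i≡j
succMod⇒≡[mod] {k} (inj₂ (1+i≡k , j≡0)) =
  trans (cong (_% suc k) 1+i≡k) (trans (n%n≡0 (suc k)) (sym (cong (_% suc k) j≡0)))

toℕ-injective-≡[mod] : ∀ {k} {i j : Fin (suc k)} → toℕ i ≡ toℕ j [mod suc k ] → i ≡ j
toℕ-injective-≡[mod] {i = i} {j} i≡j =
  toℕ-injective (trans (sym (m<n⇒m%n≡m (toℕ<n i))) (trans i≡j (m<n⇒m%n≡m (toℕ<n j))))

3≤n∧n≢4⇒n∤4 : ∀ {n} → 3 ≤ n → n ≢ 4 → n ∤ 4
3≤n∧n≢4⇒n∤4 {1} (s≤s ())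
3≤n∧n≢4⇒n∤4 {2} (s≤s (s≤s ()))
3≤n∧n≢4⇒n∤4 {3} _ _   = from-no (3 ∣? 4)
3≤n∧n≢4⇒n∤4 {4} _ 4≢4 = contradiction refl 4≢4
3≤n∧n≢4⇒n∤4 {suc (suc (suc (suc (suc _))))} _ _ = >⇒∤ (s≤s (s≤s (s≤s (s≤s (s≤s z≤n)))))

sameNeighbours⇒≡ : ∀ {k} → 3 ≤ k → k ≢ 4 → {i j : Fin k} →
                   (∀ l → CycNbr k i l → CycNbr k j l) → i ≡ j
sameNeighbours⇒≡ {suc k} 3≤k k≢4 {i} {j} i⊆j
  with s , i→s ← successor i | p , p→i ← predecessor i
  with i⊆j s (inj₁ i→s) | i⊆j p (inj₂ p→i)
... | _        | inj₂ p→j =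
  toℕ-injective-≡[mod] (trans (sym (succMod⇒≡[mod] p→i)) (succMod⇒≡[mod] p→j))
... | inj₁ j→s | inj₁ j→p = contradiction (∣⇒≤ (m+n≡n[mod]⇒∣m 2 (toℕ p) twoSteps)) (<⇒≱ 3≤k)
  where
  open ≡-Reasoning
  twoSteps : 2 + toℕ p ≡ toℕ p [mod suc k ]
  twoSteps = begin
    (2 + toℕ p) % suc k ≡⟨ +-congˡ-≡[mod] (suc k) 1 (succMod⇒≡[mod] p→i) ⟩
    (1 + toℕ i) % suc k ≡⟨ succMod⇒≡[mod] i→s ⟩
    toℕ s % suc k       ≡⟨ succMod⇒≡[mod] j→s ⟨
    (1 + toℕ j) % suc k ≡⟨ succMod⇒≡[mod] j→p ⟩
    toℕ p % suc k       ∎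
... | inj₂ s→j | inj₁ j→p =
  contradiction (m+n≡n[mod]⇒∣m 4 (toℕ i) fourSteps) (3≤n∧n≢4⇒n∤4 3≤k k≢4)
  where
  open ≡-Reasoning
  fourSteps : 4 + toℕ i ≡ toℕ i [mod suc k ]
  fourSteps = begin
    (4 + toℕ i) % suc k ≡⟨ +-congˡ-≡[mod] (suc k) 3 (succMod⇒≡[mod] i→s) ⟩
    (3 + toℕ s) % suc k ≡⟨ +-congˡ-≡[mod] (suc k) 2 (succMod⇒≡[mod] s→j) ⟩
    (2 + toℕ j) % suc k ≡⟨ +-congˡ-≡[mod] (suc k) 1 (succMod⇒≡[mod] j→p) ⟩
    (1 + toℕ p) % suc k ≡⟨ succMod⇒≡[mod] p→i ⟩
    toℕ i % suc k       ∎

module _ {N R : ℕ} .{{_ : NonZero N}} .{{_ : NonZero R}}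
         (R∣N : R ∣ N) (∣N⇒∣R : ∀ {ℓ} → Prime ℓ → ℓ ∣ N → ℓ ∣ R) where

  apart⇔apart : ∀ x y → Apart N x y ⇔ Apart R x y
  apart⇔apart x y = mk⇔ apartN⇒apartR apartR⇒apartN
    where
    apartN⇒apartR : Apart N x y → Apart R x y
    apartN⇒apartR apart ℓ-prime ℓ∣R = apart ℓ-prime (∣-trans ℓ∣R R∣N)
    apartR⇒apartN : Apart R x y → Apart N x y
    apartR⇒apartN apart ℓ-prime ℓ∣N = apart ℓ-prime (∣N⇒∣R ℓ-prime ℓ∣N)

  adj⇔adj : ∀ x {y} → y ≤ R → Adj N x y ⇔ Adj R x y
  adj⇔adj x {y} y≤R = ⇔-trans (adj⇔apart x (≤-trans y≤R (∣⇒≤ R∣N)))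
                     (⇔-trans (apart⇔apart x y) (⇔-sym (adj⇔apart x y≤R)))

  adj⇔adj-% : ∀ x {y} → y ≤ N → Adj N x y ⇔ Adj R (x % R) (y % R)
  adj⇔adj-% x {y} y≤N = ⇔-trans (adj⇔apart x y≤N)
                       (⇔-trans (apart⇔apart x y) (⇔-sym (adj-%⇔apart x y)))

  inducedCycle-lift : ∀ {k} → InducedCycle R k → InducedCycle N k
  inducedCycle-lift C = record
    { k≥3      = k≥3
    ; v        = v
    ; inRange  = λ i → <-≤-trans (inRange i) (∣⇒≤ R∣N)
    ; distinct = distinct
    ; induced  = λ i j → ⇔-trans (adj⇔adj (v i) (<⇒≤ (inRange j))) (induced i j)
    }
    where open InducedCycle C

  inducedCycle-reduce : ∀ {k} → k ≢ 4 → InducedCycle N k → InducedCycle R k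
  inducedCycle-reduce {k} k≢4 C = record
    { k≥3      = k≥3
    ; v        = w
    ; inRange  = λ i → m%n<n (v i) R
    ; distinct = λ i j wᵢ≡wⱼ → sameNeighbours⇒≡ k≥3 k≢4 λ l →
        to (induced′ j l) ∘ subst (λ z → Adj R z (w l)) wᵢ≡wⱼ ∘ from (induced′ i l)
    ; induced  = induced′
    }
    where
    open InducedCycle C
    w : Fin k → ℕ
    w i = v i % R
    induced′ : ∀ i j → Adj R (w i) (w j) ⇔ CycNbr k i j
    induced′ i j = ⇔-trans (⇔-sym (adj⇔adj-% (v i) (<⇒≤ (inRange j)))) (induced i j)

succMod? : ∀ k → Decidable (SuccMod k)
succMod? k i j = (suc (toℕ i) ≟ toℕ j) ⊎-dec ((suc (toℕ i) ≟ k) ×-dec (toℕ j ≟ 0))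

cycNbr? : ∀ k → Decidable (CycNbr k)
cycNbr? k i j = succMod? k i j ⊎-dec succMod? k j i

ResiduesDiffer : Fin 6 → Fin 6 → Set
ResiduesDiffer i j = toℕ i % 3 ≢ toℕ j % 3 × toℕ i % 2 ≢ toℕ j % 2

cycNbr⇔residuesDiffer : ∀ i j → CycNbr 6 i j ⇔ ResiduesDiffer i j
cycNbr⇔residuesDiffer i j = mk⇔ (proj₁ (table i j)) (proj₂ (table i j))
  where
  differ? : ∀ i j → Dec (ResiduesDiffer i j)
  differ? i j = ¬? (toℕ i % 3 ≟ toℕ j % 3) ×-dec ¬? (toℕ i % 2 ≟ toℕ j % 2)
  table : ∀ i j → (CycNbr 6 i j → ResiduesDiffer i j) × (ResiduesDiffer i j → CycNbr 6 i j)
  table = from-yes (all? λ i → all? λ j →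
    (cycNbr? 6 i j →-dec differ? i j) ×-dec (differ? i j →-dec cycNbr? 6 i j))

residues-injective : ∀ (i j : Fin 6) → toℕ i % 3 ≡ toℕ j % 3 → toℕ i % 2 ≡ toℕ j % 2 → i ≡ j
residues-injective = from-yes (all? λ (i : Fin 6) → all? λ (j : Fin 6) →
  (toℕ i % 3 ≟ toℕ j % 3) →-dec (toℕ i % 2 ≟ toℕ j % 2) →-dec (i Fin.≟ j))

-- Modulo q the vertex i only remembers i mod 3, modulo a prime divisor of s only i mod 2,
-- so the vertices span the tensor product K₃ × K₂, which is C₆.
inducedSixCycle : ∀ {q s p} → Prime q → Prime p → q ≢ 2 → p ∣ s → q ∤ s →
                  InducedCycle (q * s) 6
inducedSixCycle {q} {s} {p} q-prime p-prime q≢2 p∣s q∤s = record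
  { k≥3      = s≤s (s≤s (s≤s z≤n))
  ; v        = λ i → vertex i % (q * s)
  ; inRange  = λ i → m%n<n (vertex i) (q * s)
  ; distinct = distinct
  ; induced  = λ i j → ⇔-trans (adj-%⇔apart (vertex i) (vertex j))
                      (⇔-trans (apart⇔residuesDiffer i j) (⇔-sym (cycNbr⇔residuesDiffer i j)))
  }
  where
  instance
    q≢0 : NonZero q
    q≢0 = prime⇒nonZero q-prime
    p≢0 : NonZero p
    p≢0 = prime⇒nonZero p-prime
    s≢0 : NonZero s
    s≢0 = ≢-nonZero λ { refl → q∤s (q ∣0) }
    qs≢0 : NonZero (q * s)
    qs≢0 = m*n≢0 q s

  vertex : Fin 6 → ℕ
  vertex i = toℕ i % 3 * s + toℕ i % 2 * q

  vertex≡[mod-q] : ∀ i → vertex i ≡ toℕ i % 3 * s [mod q ]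
  vertex≡[mod-q] i = %-remove-+ʳ (toℕ i % 3 * s) (n∣m*n (toℕ i % 2))

  vertex≡[mod-∣s] : ∀ {ℓ} .{{_ : NonZero ℓ}} i → ℓ ∣ s → vertex i ≡ toℕ i % 2 * q [mod ℓ ]
  vertex≡[mod-∣s] i ℓ∣s = %-remove-+ˡ (toℕ i % 2 * q) (∣n⇒∣m*n (toℕ i % 3) ℓ∣s)

  3≤q : 3 ≤ q
  3≤q = ≤∧≢⇒< (nonTrivial⇒n>1 q {{prime⇒nonTrivial q-prime}}) (q≢2 ∘ sym)

  ≡[mod-q]⇔≡%3 : ∀ i j → vertex i ≡ vertex j [mod q ] ⇔ toℕ i % 3 ≡ toℕ j % 3
  ≡[mod-q]⇔≡%3 i j = mk⇔
    (λ eq → *-cancelʳ-≡[mod] q-prime q∤s (%3<q i) (%3<q j)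
              (trans (sym (vertex≡[mod-q] i)) (trans eq (vertex≡[mod-q] j))))
    (λ eq → trans (vertex≡[mod-q] i) (trans (cong (λ a → a * s % q) eq) (sym (vertex≡[mod-q] j))))
    where
    %3<q : ∀ i → toℕ i % 3 < q
    %3<q i = <-≤-trans (m%n<n (toℕ i) 3) 3≤q

  ≡[mod-∣s]⇔≡%2 : ∀ {ℓ} .{{_ : NonZero ℓ}} → Prime ℓ → ℓ ∣ s → ∀ i j →
                  vertex i ≡ vertex j [mod ℓ ] ⇔ toℕ i % 2 ≡ toℕ j % 2
  ≡[mod-∣s]⇔≡%2 {ℓ} ℓ-prime ℓ∣s i j = mk⇔
    (λ eq → *-cancelʳ-≡[mod] ℓ-prime ℓ∤q (%2<ℓ i) (%2<ℓ j)
              (trans (sym (vertex≡[mod-∣s] i ℓ∣s)) (trans eq (vertex≡[mod-∣s] j ℓ∣s))))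
    (λ eq → trans (vertex≡[mod-∣s] i ℓ∣s)
              (trans (cong (λ b → b * q % ℓ) eq) (sym (vertex≡[mod-∣s] j ℓ∣s))))
    where
    ℓ∤q : ℓ ∤ q
    ℓ∤q ℓ∣q = q∤s (subst (_∣ s) (prime∣prime⇒≡ ℓ-prime q-prime ℓ∣q) ℓ∣s)
    %2<ℓ : ∀ i → toℕ i % 2 < ℓ
    %2<ℓ i = <-≤-trans (m%n<n (toℕ i) 2) (nonTrivial⇒n>1 ℓ {{prime⇒nonTrivial ℓ-prime}})

  apart⇔residuesDiffer : ∀ i j → Apart (q * s) (vertex i) (vertex j) ⇔ ResiduesDiffer i j
  apart⇔residuesDiffer i j = mk⇔ apart⇒differ differ⇒apart
    where
    apart⇒differ : Apart (q * s) (vertex i) (vertex j) → ResiduesDiffer i j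
    apart⇒differ apart =
      (λ eq → apart q-prime (m∣m*n s) (from (≡[mod-q]⇔≡%3 i j) eq)) ,
      (λ eq → apart p-prime (∣n⇒∣m*n q p∣s) (from (≡[mod-∣s]⇔≡%2 p-prime p∣s i j) eq))
    differ⇒apart : ResiduesDiffer i j → Apart (q * s) (vertex i) (vertex j)
    differ⇒apart (≢%3 , ≢%2) ℓ-prime ℓ∣qs eq with euclidsLemma q s ℓ-prime ℓ∣qs
    ... | inj₂ ℓ∣s = ≢%2 (to (≡[mod-∣s]⇔≡%2 ℓ-prime ℓ∣s i j) eq)
    ... | inj₁ ℓ∣q with refl ← prime∣prime⇒≡ ℓ-prime q-prime ℓ∣q = ≢%3 (to (≡[mod-q]⇔≡%3 i j) eq)

  distinct : ∀ i j → vertex i % (q * s) ≡ vertex j % (q * s) → i ≡ j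
  distinct i j eq = residues-injective i j
    (to (≡[mod-q]⇔≡%3 i j) (reduce (m∣m*n s)))
    (to (≡[mod-∣s]⇔≡%2 p-prime p∣s i j) (reduce (∣n⇒∣m*n q p∣s)))
    where
    reduce : ∀ {ℓ} .{{_ : NonZero ℓ}} → ℓ ∣ q * s → vertex i ≡ vertex j [mod ℓ ]
    reduce {ℓ} ℓ∣qs = trans (sym (m∣n⇒o%n%m≡o%m ℓ (q * s) (vertex i) ℓ∣qs))
                        (trans (cong (_% ℓ) eq) (m∣n⇒o%n%m≡o%m ℓ (q * s) (vertex j) ℓ∣qs))

inducedSixCycle-twoPrimes : ∀ {p q t} → Prime p → Prime q → p ≢ q → p ∤ t → q ∤ t →
                            InducedCycle (p * (q * t)) 6
inducedSixCycle-twoPrimes {p} {q} {t} p-prime q-prime p≢q p∤t q∤t with p ≟ 2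
... | no p≢2   = inducedSixCycle p-prime q-prime p≢2 (m∣m*n t)
                   (prime∤* p-prime (p≢q ∘ prime∣prime⇒≡ p-prime q-prime) p∤t)
... | yes refl = subst (λ n → InducedCycle n 6) (x∙yz≈y∙xz *-commutativeSemigroup q 2 t)
                   (inducedSixCycle q-prime p-prime (p≢q ∘ sym) (m∣m*n t)
                     (prime∤* q-prime (p≢q ∘ sym ∘ prime∣prime⇒≡ q-prime p-prime) q∤t))

IsMaximum : (ℕ → Set) → ℕ → Set
IsMaximum P m = P m × (∀ k → P k → k ≤ m)

isMaximum⇔ : ∀ {P Q : ℕ → Set} {e w} → e < w → Q w →
             (∀ {k} → Q k → P k) → (∀ {k} → k ≢ e → P k → Q k) →
             ∀ m → IsMaximum P m ⇔ IsMaximum Q m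
isMaximum⇔ {P} {Q} {e} {w} e<w Qw Q⇒P P⇒Q m = mk⇔ maxP⇒maxQ maxQ⇒maxP
  where
  maxP⇒maxQ : IsMaximum P m → IsMaximum Q m
  maxP⇒maxQ (Pm , maxP) = P⇒Q m≢e Pm , λ k Qk → maxP k (Q⇒P Qk)
    where
    m≢e : m ≢ e
    m≢e refl = <⇒≱ e<w (maxP w (Q⇒P Qw))
  maxQ⇒maxP : IsMaximum Q m → IsMaximum P m
  maxQ⇒maxP (Qm , maxQ) = Q⇒P Qm , bound
    where
    bound : ∀ k → P k → k ≤ m
    bound k Pk with k ≟ e
    ... | yes refl = ≤-trans (<⇒≤ e<w) (maxQ w Qw)
    ... | no  k≢e  = maxQ k (P⇒Q k≢e Pk)

theorem2p10 : (r : ℕ) → 2 ≤ r → (p a : Fin r → ℕ) →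
    (∀ i → Prime (p i)) → (∀ i j → p i ≡ p j → i ≡ j) → (∀ i → 1 ≤ a i) →
    (n n′ : ℕ) → n ≡ product (tabulate (λ i → p i ^ a i)) → n′ ≡ product (tabulate p) →
    ∀ m → IsM n m ⇔ IsM n′ m
theorem2p10 (suc zero) (s≤s ()) _ _ _ _ _ _ _ _ _
theorem2p10 (suc (suc r)) _ p a p-prime p-injective a≥1 _ _ refl refl =
  isMaximum⇔ {e = 4} (s≤s (s≤s (s≤s (s≤s (s≤s z≤n))))) sixCycle
    (inducedCycle-lift n′∣n ∣n⇒∣n′) (inducedCycle-reduce n′∣n ∣n⇒∣n′)
  where
  instance
    n≢0 : NonZero (product (tabulate (λ i → p i ^ a i)))
    n≢0 = product≢0 (All.tabulate⁺ λ i → m^n≢0 (p i) (a i) {{prime⇒nonZero (p-prime i)}})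
    n′≢0 : NonZero (product (tabulate p))
    n′≢0 = productOfPrimes≢0 (All.tabulate⁺ p-prime)

  n′∣n : product (tabulate p) ∣ product (tabulate (λ i → p i ^ a i))
  n′∣n = product-tabulate-∣ {f = p} (λ i → m∣m^n (a≥1 i))

  ∣n⇒∣n′ : ∀ {ℓ} → Prime ℓ → ℓ ∣ product (tabulate (λ i → p i ^ a i)) → ℓ ∣ product (tabulate p)
  ∣n⇒∣n′ = prime∣product-^⇒prime∣product {f = p} {a}

  ∤rest : ∀ i → (∀ k → i ≢ suc (suc k)) → p i ∤ product (tabulate (λ k → p (suc (suc k))))
  ∤rest i i∉rest = prime∉⇒∤product (p-prime i) (λ k → p-prime (suc (suc k)))
                     (λ k → i∉rest k ∘ p-injective _ _)

  sixCycle : InducedCycle (product (tabulate p)) 6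
  sixCycle = inducedSixCycle-twoPrimes (p-prime zero) (p-prime (suc zero))
    ((λ ()) ∘ p-injective zero (suc zero)) (∤rest zero λ _ ()) (∤rest (suc zero) λ _ ())
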